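{- Let $(s,a_1,\dots,a_n)$ be an instance of Carry-Less Subset Sum, let $t\in\{1,\dots,n\}$ divide $n$, let $q=n/t$, $r=10^q-1$ and $k=tr+n$. For an $n$-digit decimal number $x$ and $j=1,\dots,t$, let $x^{[j]}$ be the $q$-digit number formed by the $j$-th block of $q$ consecutive decimal digits of $x$. Define over $\mathbb{F}_2$ $$q_S=\prod_{i=1}^n\Big(y_i+z_i\cdot\prod_{j=1}^t x_j^{a_i^{[j]}}\Big)\cdot\prod_{j=1}^t x_j^{\,r-s^{[j]}},$$ and let $p_S$ be the polynomial obtained from $q_S$ by removing all monomials of total degree different from $k$. Then $(s,a_1,\dots,a_n)$ is a yes-instance of Carry-Less Subset Sum if and only if $p_S$ contains an $r$-monomial.
   Context: Carry-Less Subset Sum: given $n+1$ numbers $s,a_1,\dots,a_n$, each represented by $n$ decimal digits, such that for every digit position the sum over $i$ of the corresponding digits of the $a_i$ is less than $10$, decide whether some subset of $\{a_1,\dots,a_n\}$ sums to $s$. An $r$-monomial is a monomial in which every variable has individual degree at most $r$; a polynomial contains a monomial if it has nonzero coefficient. -}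

module Defs where

open import Data.Nat using (ℕ; zero; suc; _+_; _*_; _∸_; _^_; _≤_; _<_; NonZero)
open import Data.Nat.Properties using (m^n≢0)
import Data.Nat.Properties as ℕP
open import Data.Nat.DivMod using (_/_; _%_)
open import Data.Fin using (Fin; toℕ) renaming (zero to fzero; suc to fsuc)
import Data.Fin as F
open import Data.Bool using (Bool; true; false; if_then_else_)
open import Data.Vec using (Vec; replicate; tabulate; zipWith; lookup)
import Data.Vec as V
import Data.Vec.Properties as VP
open import Data.List using (List; []; _∷_; [_]; map; concatMap; filter; length)
open import Data.Product using (_×_; _,_; Σ; ∃)
import Data.Product.Properties as PP
open import Relation.Nullary using (does; Dec)
open import Relation.Binary.PropositionalEquality using (_≡_)
open import Relation.Binary.Definitions using (DecidableEquality)

sumFin : ∀ {n} → (Fin n → ℕ) → ℕ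
sumFin {zero}  f = 0
sumFin {suc n} f = f fzero + sumFin (λ i → f (fsuc i))

-- Decimal digits and blocks (positions counted from the least significant
-- digit, starting at 0; blocks j = 0 .. t-1 likewise)

digit : ℕ → ℕ → ℕ
digit d x = _%_ (_/_ x (10 ^ d) {{m^n≢0 10 d}}) 10

block : (q : ℕ) → ℕ → ℕ → ℕ
block q j x = _%_ (_/_ x (10 ^ (q * j)) {{m^n≢0 10 (q * j)}}) (10 ^ q) {{m^n≢0 10 q}}

IsCLSSInstance : (n s : ℕ) → (Fin n → ℕ) → Set
IsCLSSInstance n s a =
  s < 10 ^ n × (∀ i → a i < 10 ^ n) ×
  (∀ d → d < n → sumFin (λ i → digit d (a i)) < 10)

YesInstance : (n s : ℕ) → (Fin n → ℕ) → Set
YesInstance n s a =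
  ∃ λ (S : Fin n → Bool) → sumFin (λ i → if S i then a i else 0) ≡ s

-- Polynomials over F₂ in variables y_1..y_n, z_1..z_n, x_1..x_t.
-- A monomial is its exponent vector (ys , zs , xs).
-- A polynomial is a formal sum (list) of monomials; the coefficient of a
-- monomial is the number of its occurrences taken mod 2.

Mono : ℕ → ℕ → Set
Mono n t = Vec ℕ n × Vec ℕ n × Vec ℕ t

_≟M_ : ∀ {n t} → DecidableEquality (Mono n t)
_≟M_ = PP.≡-dec (VP.≡-dec ℕP._≟_) (PP.≡-dec (VP.≡-dec ℕP._≟_) (VP.≡-dec ℕP._≟_))

oneM : ∀ {n t} → Mono n t
oneM = replicate _ 0 , replicate _ 0 , replicate _ 0

_·M_ : ∀ {n t} → Mono n t → Mono n t → Mono n t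
(a , b , c) ·M (a' , b' , c') = zipWith _+_ a a' , zipWith _+_ b b' , zipWith _+_ c c'

unitVec : ∀ {n} → Fin n → Vec ℕ n
unitVec i = tabulate (λ j → if does (i F.≟ j) then 1 else 0)

yM : ∀ {n t} → Fin n → Mono n t
yM i = unitVec i , replicate _ 0 , replicate _ 0

zM : ∀ {n t} → Fin n → Mono n t
zM i = replicate _ 0 , unitVec i , replicate _ 0

xPow : ∀ {n t} → (Fin t → ℕ) → Mono n t
xPow e = replicate _ 0 , replicate _ 0 , tabulate e

deg : ∀ {n t} → Mono n t → ℕ
deg (a , b , c) = V.sum a + V.sum b + V.sum c

Poly : ℕ → ℕ → Set
Poly n t = List (Mono n t)

_*P_ : ∀ {n t} → Poly n t → Poly n t → Poly n t
P *P Q = concatMap (λ m → map (m ·M_) Q) P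

prodP : ∀ {n t m} → (Fin m → Poly n t) → Poly n t
prodP {m = zero}  f = [ oneM ]
prodP {m = suc m} f = f fzero *P prodP (λ i → f (fsuc i))

coeff : ∀ {n t} → Poly n t → Mono n t → ℕ
coeff P m = length (filter (_≟M m) P) % 2

Contains : ∀ {n t} → Poly n t → Mono n t → Set
Contains P m = coeff P m ≡ 1

IsRMono : ∀ {n t} → ℕ → Mono n t → Set
IsRMono r (a , b , c) =
  (∀ i → lookup a i ≤ r) × (∀ i → lookup b i ≤ r) × (∀ j → lookup c j ≤ r)

rPar : ℕ → ℕ
rPar q = 10 ^ q ∸ 1

qS : (n t q s : ℕ) → (Fin n → ℕ) → Poly n t
qS n t q s a =
  prodP (λ i → yM i ∷ (zM i ·M xPow (λ j → block q (toℕ j) (a i))) ∷ [])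
  *P [ xPow (λ j → rPar q ∸ block q (toℕ j) s) ]

kPar : (n t q : ℕ) → ℕ
kPar n t q = t * rPar q + n

pS : (n t q s : ℕ) → (Fin n → ℕ) → Poly n t
pS n t q s a = filter (λ m → deg m ℕP.≟ kPar n t q) (qS n t q s a)

module Submission where

-- Expanding the product, q_S is the sum, over all subsets T of {1..n}, of the monomials
--   M_T = ∏_{i∉T} y_i · ∏_{i∈T} z_i · ∏_j x_j^(A_T(j) + r − s^[j]),   where A_T(j) = Σ_{i∈T} a_i^[j],
-- and distinct T give distinct monomials (the z-exponents record T), so each M_T has coefficient 1.
-- The y- and z-exponents are at most 1, and deg M_T = n + Σ_j (A_T(j) + r − s^[j]). Hence M_T is an
-- r-monomial of degree k = tr + n iff every x-exponent is at most r and their sum is tr, i.e. iff every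
-- x-exponent equals r, i.e. iff A_T(j) = s^[j] for every block j.
-- Because the digitwise sums of the a_i stay below 10, adding a subset of them produces no carries, so
-- block j of Σ_{i∈T} a_i is A_T(j); as a number below 10^n is determined by its blocks, the condition
-- says exactly that Σ_{i∈T} a_i = s.

open import Defs
open import Algebra.Properties.CommutativeSemigroup using (interchange)
open import Data.Bool using (Bool; true; false; if_then_else_)
import Data.Bool.Properties as BoolP
open import Data.Empty using (⊥-elim)
open import Data.Fin using (Fin; toℕ) renaming (zero to fzero; suc to fsuc)
import Data.Fin.Properties as FinP
open import Data.List using (List; []; _∷_; [_]; map; filter; length; _++_)
import Data.List.Properties as LP
open import Data.Nat using (ℕ; zero; suc; _+_; _*_; _∸_; _^_; _≤_; _<_; z≤n; s≤s; NonZero; >-nonZero⁻¹)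
open import Data.Nat.Properties
open import Data.Nat.DivMod
open import Data.Nat.Divisibility using (n∣m*n)
open import Data.Product using (_×_; _,_; proj₁; proj₂; ∃)
open import Data.Vec as V using (Vec; []; _∷_; lookup; zipWith; replicate; tabulate)
import Data.Vec.Properties as VP
open import Function using (_∘_; _⇔_; mk⇔; Equivalence)
open import Function.Definitions using (Injective)
import Function.Properties.Equivalence as ⇔
open import Relation.Binary.Definitions using (DecidableEquality)
open import Relation.Binary.PropositionalEquality
  using (_≡_; _≢_; refl; sym; trans; cong; cong₂; subst; module ≡-Reasoning)
open import Relation.Nullary using (yes; no; ¬_)
open import Relation.Nullary.Decidable using (dec-true; dec-false)
open import Relation.Unary using (Decidable)

open Equivalence using (to; from)

sumFin-cong : ∀ {m} {f g : Fin m → ℕ} → (∀ i → f i ≡ g i) → sumFin f ≡ sumFin g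
sumFin-cong {zero}  f≗g = refl
sumFin-cong {suc m} f≗g = cong₂ _+_ (f≗g fzero) (sumFin-cong (f≗g ∘ fsuc))

sumFin-zero : ∀ m → sumFin {m} (λ _ → 0) ≡ 0
sumFin-zero zero    = refl
sumFin-zero (suc m) = sumFin-zero m

sumFin-const : ∀ m c → sumFin {m} (λ _ → c) ≡ m * c
sumFin-const zero    c = refl
sumFin-const (suc m) c = cong (c +_) (sumFin-const m c)

sumFin-distrib-+ : ∀ {m} (f g : Fin m → ℕ) → sumFin (λ i → f i + g i) ≡ sumFin f + sumFin g
sumFin-distrib-+ {zero}  f g = refl
sumFin-distrib-+ {suc m} f g =
  trans (cong (f fzero + g fzero +_) (sumFin-distrib-+ (f ∘ fsuc) (g ∘ fsuc)))
        (interchange +-commutativeSemigroup (f fzero) (g fzero) _ _)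

sumFin-distribʳ-* : ∀ {m} (f : Fin m → ℕ) c → sumFin (λ i → f i * c) ≡ sumFin f * c
sumFin-distribʳ-* {zero}  f c = refl
sumFin-distribʳ-* {suc m} f c =
  trans (cong (f fzero * c +_) (sumFin-distribʳ-* (f ∘ fsuc) c)) (sym (*-distribʳ-+ c (f fzero) _))

sumFin-mono-≤ : ∀ {m} {f g : Fin m → ℕ} → (∀ i → f i ≤ g i) → sumFin f ≤ sumFin g
sumFin-mono-≤ {zero}  f≤g = z≤n
sumFin-mono-≤ {suc m} f≤g = +-mono-≤ (f≤g fzero) (sumFin-mono-≤ (f≤g ∘ fsuc))

sumFin-≤-≡⇒≗ : ∀ {m} {f g : Fin m → ℕ} → (∀ i → f i ≤ g i) → sumFin f ≡ sumFin g →
  ∀ i → f i ≡ g i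
sumFin-≤-≡⇒≗ {suc m} {f} {g} f≤g Σf≡Σg = pointwise
  where
  tail≤ : sumFin (f ∘ fsuc) ≤ sumFin (g ∘ fsuc)
  tail≤ = sumFin-mono-≤ (f≤g ∘ fsuc)
  head≡ : f fzero ≡ g fzero
  head≡ = ≤-antisym (f≤g fzero)
    (+-cancelʳ-≤ _ _ _ (subst (_≤ f fzero + sumFin (g ∘ fsuc)) Σf≡Σg (+-monoʳ-≤ (f fzero) tail≤)))
  tail≡ : sumFin (f ∘ fsuc) ≡ sumFin (g ∘ fsuc)
  tail≡ = +-cancelˡ-≡ (f fzero) _ _ (trans Σf≡Σg (cong (_+ _) (sym head≡)))
  pointwise : ∀ i → f i ≡ g i
  pointwise fzero    = head≡
  pointwise (fsuc i) = sumFin-≤-≡⇒≗ (f≤g ∘ fsuc) tail≡ i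

sumFin-supported : ∀ {m} (j : Fin m) (g : Fin m → ℕ) → (∀ i → i ≢ j → g i ≡ 0) → sumFin g ≡ g j
sumFin-supported {suc m} fzero g off =
  trans (cong (g fzero +_) (trans (sumFin-cong (λ i → off (fsuc i) λ ())) (sumFin-zero m))) (+-identityʳ _)
sumFin-supported {suc m} (fsuc j) g off =
  cong₂ _+_ (off fzero λ ())
            (sumFin-supported j (g ∘ fsuc) (λ i i≢j → off (fsuc i) (i≢j ∘ FinP.suc-injective)))

subsetSum : ∀ {m} → (Fin m → Bool) → (Fin m → ℕ) → ℕ
subsetSum S x = sumFin (λ i → if S i then x i else 0)

subsetSum-cong : ∀ {m} (S : Fin m → Bool) {x y : Fin m → ℕ} → (∀ i → x i ≡ y i) →
  subsetSum S x ≡ subsetSum S y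
subsetSum-cong S x≗y = sumFin-cong (λ i → cong (if S i then_else 0) (x≗y i))

if-then-0-natural : ∀ (f : ℕ → ℕ) → f 0 ≡ 0 →
  ∀ b x → f (if b then x else 0) ≡ (if b then f x else 0)
if-then-0-natural f f0≡0 true  x = refl
if-then-0-natural f f0≡0 false x = f0≡0

m%[n*o]≡m%o+m/o%n*o : ∀ m n o .{{_ : NonZero n}} .{{_ : NonZero o}} {{_ : NonZero (n * o)}} →
  m % (n * o) ≡ m % o + m / o % n * o
m%[n*o]≡m%o+m/o%n*o m n o = begin
  m % (n * o)
    ≡⟨ m≡m%n+[m/n]*n (m % (n * o)) o ⟩
  m % (n * o) % o + m % (n * o) / o * o
    ≡⟨ cong₂ (λ u v → u + v * o) (m∣n⇒o%n%m≡o%m o (n * o) m (n∣m*n n)) (m%[n*o]/o≡m/o%n m n o) ⟩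
  m % o + m / o % n * o ∎
  where open ≡-Reasoning

[m+kn]/n≡k : ∀ m k n .{{_ : NonZero n}} → m < n → (m + k * n) / n ≡ k
[m+kn]/n≡k m k n m<n = begin
  (m + k * n) / n    ≡⟨ +-distrib-/-∣ʳ m (n∣m*n k) ⟩
  m / n + k * n / n  ≡⟨ cong₂ _+_ (m<n⇒m/n≡0 m<n) (m*n/n≡m k n) ⟩
  k                  ∎
  where open ≡-Reasoning

sumFin-%-/ : ∀ {m} (x : Fin m → ℕ) n .{{_ : NonZero n}} → sumFin (λ i → x i % n) < n →
  (sumFin x % n ≡ sumFin (λ i → x i % n)) × (sumFin x / n ≡ sumFin (λ i → x i / n))
sumFin-%-/ x n rems<n =
  trans (cong (_% n) Σx≡R+Q*n) (trans ([m+kn]%n≡m%n R Q n) (m<n⇒m%n≡m rems<n)) ,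
  trans (cong (_/ n) Σx≡R+Q*n) ([m+kn]/n≡k R Q n rems<n)
  where
  R Q : ℕ
  R = sumFin (λ i → x i % n)
  Q = sumFin (λ i → x i / n)
  Σx≡R+Q*n : sumFin x ≡ R + Q * n
  Σx≡R+Q*n = begin
    sumFin x                                ≡⟨ sumFin-cong (λ i → m≡m%n+[m/n]*n (x i) n) ⟩
    sumFin (λ i → x i % n + x i / n * n)    ≡⟨ sumFin-distrib-+ (λ i → x i % n) (λ i → x i / n * n) ⟩
    R + sumFin (λ i → x i / n * n)          ≡⟨ cong (R +_) (sumFin-distribʳ-* (λ i → x i / n) n) ⟩
    R + Q * n                               ∎
    where open ≡-Reasoning

m<o∧n<p⇒m+n*o<p*o : ∀ {m n o p} → m < o → n < p → m + n * o < p * o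
m<o∧n<p⇒m+n*o<p*o {n = n} {o} m<o n<p = <-≤-trans (+-monoˡ-< (n * o) m<o) (*-monoˡ-≤ o n<p)

module Positional (b : ℕ) .{{b≢0 : NonZero b}} where

  _/b^_ : ℕ → ℕ → ℕ
  x /b^ L = _/_ x (b ^ L) {{m^n≢0 b L}}

  _%b^_ : ℕ → ℕ → ℕ
  x %b^ L = _%_ x (b ^ L) {{m^n≢0 b L}}

  digitAt : ℕ → ℕ → ℕ
  digitAt d x = x /b^ d % b

  CarryLess : ∀ {m} → ℕ → (Fin m → ℕ) → Set
  CarryLess L x = ∀ d → d < L → sumFin (λ i → digitAt d (x i)) < b

  CarryLess-mono : ∀ {m L L′} {x : Fin m → ℕ} → L′ ≤ L → CarryLess L x → CarryLess L′ x
  CarryLess-mono L′≤L cl d d<L′ = cl d (<-≤-trans d<L′ L′≤L)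

  digitAt-zero : ∀ x → digitAt 0 x ≡ x % b
  digitAt-zero x = %-congˡ (n/1≡n x)

  digitAt-/b^ : ∀ L d x → digitAt d (x /b^ L) ≡ digitAt (L + d) x
  digitAt-/b^ L d x =
    %-congˡ (trans (m/n/o≡m/[n*o] x (b ^ L) (b ^ d)) (/-congʳ (sym (^-distribˡ-+-* b L d))))
    where instance
      b^L≢0 : NonZero (b ^ L)
      b^L≢0 = m^n≢0 b L
      b^d≢0 : NonZero (b ^ d)
      b^d≢0 = m^n≢0 b d
      b^[L+d]≢0 : NonZero (b ^ (L + d))
      b^[L+d]≢0 = m^n≢0 b (L + d)
      b^L*b^d≢0 : NonZero (b ^ L * b ^ d)
      b^L*b^d≢0 = m*n≢0 (b ^ L) (b ^ d)

  digitAt-suc : ∀ d x → digitAt (suc d) x ≡ digitAt d (x / b)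
  digitAt-suc d x = trans (sym (digitAt-/b^ 1 d x)) (cong (digitAt d) (/-congʳ {{m^n≢0 b 1}} (*-identityʳ b)))

  digitAt-of-0 : ∀ d → digitAt d 0 ≡ 0
  digitAt-of-0 d = trans (%-congˡ (0/n≡0 (b ^ d) {{m^n≢0 b d}})) (m<n⇒m%n≡m (>-nonZero⁻¹ b))

  %b^-suc : ∀ L x → x %b^ suc L ≡ x %b^ L + digitAt L x * b ^ L
  %b^-suc L x = m%[n*o]≡m%o+m/o%n*o x b (b ^ L) {{_}} {{m^n≢0 b L}} {{m^n≢0 b (suc L)}}

  CarryLess-/ : ∀ {m L} {x : Fin m → ℕ} → CarryLess (suc L) x → CarryLess L (λ i → x i / b)
  CarryLess-/ {x = x} cl d d<L =
    subst (_< b) (sumFin-cong (λ i → digitAt-suc d (x i))) (cl (suc d) (s≤s d<L))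

  CarryLess-subset : ∀ {m L} {x : Fin m → ℕ} (S : Fin m → Bool) →
    CarryLess L x → CarryLess L (λ i → if S i then x i else 0)
  CarryLess-subset {x = x} S cl d d<L = ≤-<-trans (sumFin-mono-≤ selected≤) (cl d d<L)
    where
    selected≤ : ∀ i → digitAt d (if S i then x i else 0) ≤ digitAt d (x i)
    selected≤ i with S i
    ... | true  = ≤-refl
    ... | false = ≤-trans (≤-reflexive (digitAt-of-0 d)) z≤n

  sumFin-%b^< : ∀ {m} L (x : Fin m → ℕ) → CarryLess L x → sumFin (λ i → x i %b^ L) < b ^ L
  sumFin-%b^< {m} zero x cl =
    subst (_< 1) (sym (trans (sumFin-cong (λ i → n%1≡0 (x i))) (sumFin-zero m))) (s≤s z≤n)
  sumFin-%b^< (suc L) x cl = begin-strict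
    sumFin (λ i → x i %b^ suc L)
      ≡⟨ sumFin-cong (λ i → %b^-suc L (x i)) ⟩
    sumFin (λ i → x i %b^ L + digitAt L (x i) * b ^ L)
      ≡⟨ sumFin-distrib-+ (λ i → x i %b^ L) _ ⟩
    lower + sumFin (λ i → digitAt L (x i) * b ^ L)
      ≡⟨ cong (lower +_) (sumFin-distribʳ-* (λ i → digitAt L (x i)) (b ^ L)) ⟩
    lower + sumFin (λ i → digitAt L (x i)) * b ^ L
      <⟨ m<o∧n<p⇒m+n*o<p*o lower<b^L (cl L ≤-refl) ⟩
    b * b ^ L ∎
    where
    open ≤-Reasoning
    lower : ℕ
    lower = sumFin (λ i → x i %b^ L)
    lower<b^L : lower < b ^ L
    lower<b^L = sumFin-%b^< L x (CarryLess-mono {x = x} (n≤1+n L) cl)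

  sumFin<b^ : ∀ {m} L (x : Fin m → ℕ) → CarryLess L x → (∀ i → x i < b ^ L) → sumFin x < b ^ L
  sumFin<b^ L x cl x<b^L =
    subst (_< b ^ L) (sumFin-cong (λ i → m<n⇒m%n≡m {{m^n≢0 b L}} (x<b^L i))) (sumFin-%b^< L x cl)

  sumFin-%-/-base : ∀ {m} (x : Fin m → ℕ) → CarryLess 1 x →
    (sumFin x % b ≡ sumFin (λ i → x i % b)) × (sumFin x / b ≡ sumFin (λ i → x i / b))
  sumFin-%-/-base x cl =
    sumFin-%-/ x b (subst (_< b) (sumFin-cong (λ i → digitAt-zero (x i))) (cl 0 (s≤s z≤n)))

  digitAt-sumFin : ∀ {m} d (x : Fin m → ℕ) → CarryLess (suc d) x →
    digitAt d (sumFin x) ≡ sumFin (λ i → digitAt d (x i))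
  digitAt-sumFin zero x cl = begin
    digitAt 0 (sumFin x)           ≡⟨ digitAt-zero (sumFin x) ⟩
    sumFin x % b                   ≡⟨ proj₁ (sumFin-%-/-base x cl) ⟩
    sumFin (λ i → x i % b)         ≡⟨ sumFin-cong (λ i → sym (digitAt-zero (x i))) ⟩
    sumFin (λ i → digitAt 0 (x i)) ∎
    where open ≡-Reasoning
  digitAt-sumFin (suc d) x cl = begin
    digitAt (suc d) (sumFin x)              ≡⟨ digitAt-suc d (sumFin x) ⟩
    digitAt d (sumFin x / b)                ≡⟨ cong (digitAt d) (proj₂ (sumFin-%-/-base x lowestDigit)) ⟩
    digitAt d (sumFin (λ i → x i / b))      ≡⟨ digitAt-sumFin d (λ i → x i / b) (CarryLess-/ {x = x} cl) ⟩
    sumFin (λ i → digitAt d (x i / b))      ≡⟨ sumFin-cong (λ i → sym (digitAt-suc d (x i))) ⟩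
    sumFin (λ i → digitAt (suc d) (x i))    ∎
    where
    open ≡-Reasoning
    lowestDigit : CarryLess 1 x
    lowestDigit = CarryLess-mono {x = x} (s≤s z≤n) cl

  subsetSum-digitAt : ∀ {m} d (S : Fin m → Bool) (x : Fin m → ℕ) → CarryLess (suc d) x →
    digitAt d (subsetSum S x) ≡ subsetSum S (λ i → digitAt d (x i))
  subsetSum-digitAt d S x cl =
    trans (digitAt-sumFin d (λ i → if S i then x i else 0) (CarryLess-subset S cl))
          (sumFin-cong (λ i → if-then-0-natural (digitAt d) (digitAt-of-0 d) (S i) (x i)))

  digits-injective : ∀ D {x y} → x < b ^ D → y < b ^ D →
    (∀ (d : Fin D) → digitAt (toℕ d) x ≡ digitAt (toℕ d) y) → x ≡ y
  digits-injective zero    x<1 y<1 _ = trans (n<1⇒n≡0 x<1) (sym (n<1⇒n≡0 y<1))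
  digits-injective (suc D) {x} {y} x<b^1+D y<b^1+D same = begin
    x                  ≡⟨ m≡m%n+[m/n]*n x b ⟩
    x % b + x / b * b  ≡⟨ cong₂ (λ u v → u + v * b) low≡ high≡ ⟩
    y % b + y / b * b  ≡⟨ sym (m≡m%n+[m/n]*n y b) ⟩
    y                  ∎
    where
    open ≡-Reasoning
    /b< : ∀ {z} → z < b ^ suc D → z / b < b ^ D
    /b< {z} z< = m<n*o⇒m/o<n (subst (z <_) (*-comm b (b ^ D)) z<)
    low≡ : x % b ≡ y % b
    low≡ = trans (sym (digitAt-zero x)) (trans (same fzero) (digitAt-zero y))
    high≡ : x / b ≡ y / b
    high≡ = digits-injective D (/b< x<b^1+D) (/b< y<b^1+D)
      (λ d → trans (sym (digitAt-suc (toℕ d) x)) (trans (same (fsuc d)) (digitAt-suc (toℕ d) y)))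

open Positional 10 using (CarryLess; _/b^_; digitAt-/b^; sumFin-%b^<; CarryLess-subset; sumFin<b^)

module Blocks (q : ℕ) = Positional (10 ^ q) {{m^n≢0 10 q}}

block≡digitAt : ∀ q j x → block q j x ≡ Blocks.digitAt q j x
block≡digitAt q j x =
  %-congˡ {{m^n≢0 10 q}}
    (/-congʳ {{m^n≢0 10 (q * j)}} {{m^n≢0 (10 ^ q) j {{m^n≢0 10 q}}}} (sym (^-*-assoc 10 q j)))

CarryLess-blocks : ∀ {m} q t (x : Fin m → ℕ) → CarryLess (t * q) x → Blocks.CarryLess q t x
CarryLess-blocks q t x cl j j<t = subst (_< 10 ^ q) (sumFin-cong (λ i → block≡digitAt q j (x i)))
  (sumFin-%b^< q (λ i → x i /b^ (q * j)) shiftedCarryLess)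
  where
  shiftedCarryLess : CarryLess q (λ i → x i /b^ (q * j))
  shiftedCarryLess d d<q = subst (_< 10) (sym (sumFin-cong (λ i → digitAt-/b^ (q * j) d (x i))))
    (cl (q * j + d) (subst (_< t * q) (trans (+-comm d (j * q)) (cong (_+ d) (*-comm j q)))
                                      (m<o∧n<p⇒m+n*o<p*o d<q j<t)))

subsetSum⇔blockSums : ∀ {n} t q s (a : Fin n → ℕ) → IsCLSSInstance n s a → t * q ≡ n →
  ∀ S → subsetSum S a ≡ s ⇔
        (∀ (j : Fin t) → subsetSum S (λ i → block q (toℕ j) (a i)) ≡ block q (toℕ j) s)
subsetSum⇔blockSums t q s a (s<10^n , a<10^n , cl) refl S =
  mk⇔ (λ sum≡s j → trans (sym (block-subsetSum j)) (cong (block q (toℕ j)) sum≡s)) fromBlocks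
  where
  block-subsetSum : ∀ (j : Fin t) →
    block q (toℕ j) (subsetSum S a) ≡ subsetSum S (λ i → block q (toℕ j) (a i))
  block-subsetSum j = begin
    block q (toℕ j) (subsetSum S a)
      ≡⟨ block≡digitAt q (toℕ j) (subsetSum S a) ⟩
    Blocks.digitAt q (toℕ j) (subsetSum S a)
      ≡⟨ Blocks.subsetSum-digitAt q (toℕ j) S a
           (Blocks.CarryLess-mono q {x = a} (FinP.toℕ<n j) (CarryLess-blocks q t a cl)) ⟩
    subsetSum S (λ i → Blocks.digitAt q (toℕ j) (a i))
      ≡⟨ subsetSum-cong S (λ i → sym (block≡digitAt q (toℕ j) (a i))) ⟩
    subsetSum S (λ i → block q (toℕ j) (a i)) ∎
    where open ≡-Reasoning
  10^n≡B^t : 10 ^ (t * q) ≡ (10 ^ q) ^ t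
  10^n≡B^t = trans (cong (10 ^_) (*-comm t q)) (sym (^-*-assoc 10 q t))
  selected<10^n : ∀ i → (if S i then a i else 0) < 10 ^ (t * q)
  selected<10^n i with S i
  ... | true  = a<10^n i
  ... | false = m^n>0 10 (t * q)
  subsetSum<10^n : subsetSum S a < 10 ^ (t * q)
  subsetSum<10^n = sumFin<b^ (t * q) _ (CarryLess-subset S cl) selected<10^n
  fromBlocks : (∀ (j : Fin t) → subsetSum S (λ i → block q (toℕ j) (a i)) ≡ block q (toℕ j) s) →
               subsetSum S a ≡ s
  fromBlocks blockSums = Blocks.digits-injective q t
    (subst (subsetSum S a <_) 10^n≡B^t subsetSum<10^n) (subst (s <_) 10^n≡B^t s<10^n)
    (λ j → trans (sym (block≡digitAt q (toℕ j) (subsetSum S a)))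
                 (trans (trans (block-subsetSum j) (blockSums j)) (block≡digitAt q (toℕ j) s)))

occ : ∀ {A : Set} → DecidableEquality A → A → List A → ℕ
occ _≟_ x xs = length (filter (_≟ x) xs)

module _ {A : Set} (_≟_ : DecidableEquality A) where

  occ-++ : ∀ x xs ys → occ _≟_ x (xs ++ ys) ≡ occ _≟_ x xs + occ _≟_ x ys
  occ-++ x xs ys = trans (cong length (LP.filter-++ (_≟ x) xs ys)) (LP.length-++ (filter (_≟ x) xs))

  occ-filter-accept : ∀ {P : A → Set} (P? : Decidable P) {x} xs → P x →
    occ _≟_ x (filter P? xs) ≡ occ _≟_ x xs
  occ-filter-accept P? []       px = refl
  occ-filter-accept P? {x} (y ∷ xs) px with P? y
  ... | yes _ with y ≟ x
  ...   | yes _ = cong suc (occ-filter-accept P? xs px)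
  ...   | no _  = occ-filter-accept P? xs px
  occ-filter-accept {P} P? {x} (y ∷ xs) px | no ¬py with y ≟ x
  ...   | yes y≡x = ⊥-elim (¬py (subst P (sym y≡x) px))
  ...   | no _    = occ-filter-accept P? xs px

  occ-filter-reject : ∀ {P : A → Set} (P? : Decidable P) {x} xs → ¬ P x → occ _≟_ x (filter P? xs) ≡ 0
  occ-filter-reject P? []       ¬px = refl
  occ-filter-reject {P} P? {x} (y ∷ xs) ¬px with P? y
  ... | no _ = occ-filter-reject P? xs ¬px
  ... | yes py with y ≟ x
  ...   | yes y≡x = ⊥-elim (¬px (subst P y≡x py))
  ...   | no _    = occ-filter-reject P? xs ¬px

module _ {A B : Set} (_≟A_ : DecidableEquality A) (_≟B_ : DecidableEquality B) (f : A → B) where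

  occ-map-injective : Injective _≡_ _≡_ f → ∀ x xs → occ _≟B_ (f x) (map f xs) ≡ occ _≟A_ x xs
  occ-map-injective inj x []       = refl
  occ-map-injective inj x (y ∷ xs) with f y ≟B f x | y ≟A x
  ... | yes _      | yes _   = cong suc (occ-map-injective inj x xs)
  ... | no _       | no _    = occ-map-injective inj x xs
  ... | yes fy≡fx  | no y≢x  = ⊥-elim (y≢x (inj fy≡fx))
  ... | no fy≢fx   | yes y≡x = ⊥-elim (fy≢fx (cong f y≡x))

  occ-map-∉ : ∀ x xs → (∀ y → f y ≢ x) → occ _≟B_ x (map f xs) ≡ 0
  occ-map-∉ x []       ∉ = refl
  occ-map-∉ x (y ∷ xs) ∉ with f y ≟B x
  ... | yes fy≡x = ⊥-elim (∉ y fy≡x)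
  ... | no _     = occ-map-∉ x xs ∉

  occ-map⇒preimage : ∀ x xs → occ _≟B_ x (map f xs) ≢ 0 → ∃ λ y → f y ≡ x
  occ-map⇒preimage x []       occ≢0 = ⊥-elim (occ≢0 refl)
  occ-map⇒preimage x (y ∷ xs) occ≢0 with f y ≟B x
  ... | yes fy≡x = y , fy≡x
  ... | no _     = occ-map⇒preimage x xs occ≢0

allBits : (m : ℕ) → List (Vec Bool m)
allBits zero    = [ [] ]
allBits (suc m) = map (false ∷_) (allBits m) ++ map (true ∷_) (allBits m)

_≟B_ : ∀ {m} → DecidableEquality (Vec Bool m)
_≟B_ = VP.≡-dec BoolP._≟_

occ-allBits : ∀ {m} (bs : Vec Bool m) → occ _≟B_ bs (allBits m) ≡ 1
occ-allBits []       = refl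
occ-allBits {suc m} (b ∷ bs) = trans (occ-++ _≟B_ (b ∷ bs) (map (false ∷_) (allBits m)) _) (halves b)
  where
  occ-cons : ∀ b → occ _≟B_ (b ∷ bs) (map (b ∷_) (allBits m)) ≡ 1
  occ-cons b = trans (occ-map-injective _≟B_ _≟B_ (b ∷_) VP.∷-injectiveʳ bs (allBits m)) (occ-allBits bs)
  occ-other : ∀ b b′ → b ≢ b′ → occ _≟B_ (b ∷ bs) (map (b′ ∷_) (allBits m)) ≡ 0
  occ-other b b′ b≢b′ =
    occ-map-∉ _≟B_ _≟B_ (b′ ∷_) (b ∷ bs) (allBits m) (λ _ eq → b≢b′ (sym (VP.∷-injectiveˡ eq)))
  halves : ∀ b →
    occ _≟B_ (b ∷ bs) (map (false ∷_) (allBits m)) + occ _≟B_ (b ∷ bs) (map (true ∷_) (allBits m)) ≡ 1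
  halves false = cong₂ _+_ (occ-cons false) (occ-other false true λ ())
  halves true  = cong₂ _+_ (occ-other true false λ ()) (occ-cons true)

yExps zExps : ∀ {n t} → Mono n t → Vec ℕ n
yExps = proj₁
zExps = proj₁ ∘ proj₂

xExps : ∀ {n t} → Mono n t → Vec ℕ t
xExps = proj₂ ∘ proj₂

deg≡sumFin : ∀ {n t} (m : Mono n t) →
  deg m ≡ sumFin (lookup (yExps m)) + sumFin (lookup (zExps m)) + sumFin (lookup (xExps m))
deg≡sumFin (ys , zs , xs) = cong₂ _+_ (cong₂ _+_ (sum≡sumFin ys) (sum≡sumFin zs)) (sum≡sumFin xs)
  where
  sum≡sumFin : ∀ {k} (v : Vec ℕ k) → V.sum v ≡ sumFin (lookup v)
  sum≡sumFin []       = refl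
  sum≡sumFin (x ∷ v) = cong (x +_) (sum≡sumFin v)

lookup-0+ : ∀ {k} (v : Vec ℕ k) j → lookup (zipWith _+_ (replicate k 0) v) j ≡ lookup v j
lookup-0+ {k} v j =
  trans (VP.lookup-zipWith _+_ j (replicate k 0) v) (cong (_+ lookup v j) (VP.lookup-replicate j 0))

lookup-+0 : ∀ {k} (v : Vec ℕ k) j → lookup (zipWith _+_ v (replicate k 0)) j ≡ lookup v j
lookup-+0 v j =
  trans (VP.lookup-zipWith _+_ j v _) (trans (cong (lookup v j +_) (VP.lookup-replicate j 0)) (+-identityʳ _))

unitVec-diag : ∀ {n} (i : Fin n) → lookup (unitVec i) i ≡ 1
unitVec-diag i = trans (VP.lookup∘tabulate _ i) (cong (if_then 1 else 0) (dec-true (i FinP.≟ i) refl))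

unitVec-offDiag : ∀ {n} {i j : Fin n} → i ≢ j → lookup (unitVec i) j ≡ 0
unitVec-offDiag {i = i} {j} i≢j =
  trans (VP.lookup∘tabulate _ j) (cong (if_then 1 else 0) (dec-false (i FinP.≟ j) i≢j))

prodM : ∀ {m n t} → (Fin m → Mono n t) → Mono n t
prodM {zero}  F = oneM
prodM {suc m} F = F fzero ·M prodM (F ∘ fsuc)

lookup-prodM : ∀ {m n t k} (exps : Mono n t → Vec ℕ k) →
  (∀ u v → exps (u ·M v) ≡ zipWith _+_ (exps u) (exps v)) → exps oneM ≡ replicate k 0 →
  ∀ (F : Fin m → Mono n t) j → lookup (exps (prodM F)) j ≡ sumFin (λ i → lookup (exps (F i)) j)
lookup-prodM {zero}  exps exps-· exps-one F j =
  trans (cong (λ v → lookup v j) exps-one) (VP.lookup-replicate j 0)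
lookup-prodM {suc m} exps exps-· exps-one F j =
  trans (cong (λ v → lookup v j) (exps-· (F fzero) (prodM (F ∘ fsuc))))
        (trans (VP.lookup-zipWith _+_ j (exps (F fzero)) _)
               (cong (lookup (exps (F fzero)) j +_) (lookup-prodM exps exps-· exps-one (F ∘ fsuc) j)))

choose : ∀ {m n t} (u v : Fin m → Mono n t) → Vec Bool m → Mono n t
choose u v bs = prodM (λ i → if lookup bs i then v i else u i)

*P-singleton : ∀ {n t} (P : Poly n t) w → P *P [ w ] ≡ map (_·M w) P
*P-singleton []      w = refl
*P-singleton (m ∷ P) w = cong (m ·M w ∷_) (*P-singleton P w)

prodP-binomials : ∀ {m n t} (u v : Fin m → Mono n t) →
  prodP (λ i → u i ∷ v i ∷ []) ≡ map (choose u v) (allBits m)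
prodP-binomials {zero}  u v = refl
prodP-binomials {suc m} {n} {t} u v = begin
  map (u fzero ·M_) P ++ (map (v fzero ·M_) P ++ [])
    ≡⟨ cong (map (u fzero ·M_) P ++_) (LP.++-identityʳ _) ⟩
  map (u fzero ·M_) P ++ map (v fzero ·M_) P
    ≡⟨ cong (λ Q → map (u fzero ·M_) Q ++ map (v fzero ·M_) Q) (prodP-binomials (u ∘ fsuc) (v ∘ fsuc)) ⟩
  map (u fzero ·M_) (map C A) ++ map (v fzero ·M_) (map C A)
    ≡⟨ sym (cong₂ _++_ (LP.map-∘ A) (LP.map-∘ A)) ⟩
  map (choose u v ∘ (false ∷_)) A ++ map (choose u v ∘ (true ∷_)) A
    ≡⟨ cong₂ _++_ (LP.map-∘ A) (LP.map-∘ A) ⟩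
  map (choose u v) (map (false ∷_) A) ++ map (choose u v) (map (true ∷_) A)
    ≡⟨ sym (LP.map-++ (choose u v) (map (false ∷_) A) _) ⟩
  map (choose u v) (allBits (suc m)) ∎
  where
  open ≡-Reasoning
  P : Poly n t
  P = prodP (λ i → u (fsuc i) ∷ v (fsuc i) ∷ [])
  A : List (Vec Bool m)
  A = allBits m
  C : Vec Bool m → Mono n t
  C = choose (u ∘ fsuc) (v ∘ fsuc)

module SubsetMonomial {n t : ℕ} (h : Fin n → Fin t → ℕ) (c : Fin t → ℕ) where

  factor : Vec Bool n → Fin n → Mono n t
  factor bs i = if lookup bs i then zM i ·M xPow (h i) else yM i

  subsetMono : Vec Bool n → Mono n t
  subsetMono bs = prodM (factor bs) ·M xPow c

  expansion : prodP (λ i → yM i ∷ (zM i ·M xPow (h i)) ∷ []) *P [ xPow c ] ≡ map subsetMono (allBits n)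
  expansion = trans (cong (_*P [ xPow c ]) (prodP-binomials yM (λ i → zM i ·M xPow (h i))))
                    (trans (*P-singleton _ (xPow c)) (sym (LP.map-∘ (allBits n))))

  yExp-factor-offDiag : ∀ bs {i j} → i ≢ j → lookup (yExps (factor bs i)) j ≡ 0
  yExp-factor-offDiag bs {i} {j} i≢j with lookup bs i
  ... | true  = trans (lookup-0+ (replicate n 0) j) (VP.lookup-replicate j 0)
  ... | false = unitVec-offDiag i≢j

  yExp-factor-diag : ∀ bs j → lookup (yExps (factor bs j)) j ≡ (if lookup bs j then 0 else 1)
  yExp-factor-diag bs j with lookup bs j
  ... | true  = trans (lookup-0+ (replicate n 0) j) (VP.lookup-replicate j 0)
  ... | false = unitVec-diag j

  zExp-factor-offDiag : ∀ bs {i j} → i ≢ j → lookup (zExps (factor bs i)) j ≡ 0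
  zExp-factor-offDiag bs {i} {j} i≢j with lookup bs i
  ... | true  = trans (lookup-+0 (unitVec i) j) (unitVec-offDiag i≢j)
  ... | false = VP.lookup-replicate j 0

  zExp-factor-diag : ∀ bs j → lookup (zExps (factor bs j)) j ≡ (if lookup bs j then 1 else 0)
  zExp-factor-diag bs j with lookup bs j
  ... | true  = trans (lookup-+0 (unitVec j) j) (unitVec-diag j)
  ... | false = VP.lookup-replicate j 0

  xExp-factor : ∀ bs i j → lookup (xExps (factor bs i)) j ≡ (if lookup bs i then h i j else 0)
  xExp-factor bs i j with lookup bs i
  ... | true  = trans (lookup-0+ (tabulate (h i)) j) (VP.lookup∘tabulate (h i) j)
  ... | false = VP.lookup-replicate j 0

  yExp-subsetMono : ∀ bs j → lookup (yExps (subsetMono bs)) j ≡ (if lookup bs j then 0 else 1)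
  yExp-subsetMono bs j = begin
    lookup (yExps (subsetMono bs)) j               ≡⟨ lookup-+0 (yExps (prodM (factor bs))) j ⟩
    lookup (yExps (prodM (factor bs))) j           ≡⟨ lookup-prodM yExps (λ _ _ → refl) refl (factor bs) j ⟩
    sumFin (λ i → lookup (yExps (factor bs i)) j)  ≡⟨ sumFin-supported j _ (λ i → yExp-factor-offDiag bs) ⟩
    lookup (yExps (factor bs j)) j                 ≡⟨ yExp-factor-diag bs j ⟩
    (if lookup bs j then 0 else 1)                   ∎
    where open ≡-Reasoning

  zExp-subsetMono : ∀ bs j → lookup (zExps (subsetMono bs)) j ≡ (if lookup bs j then 1 else 0)
  zExp-subsetMono bs j = begin
    lookup (zExps (subsetMono bs)) j               ≡⟨ lookup-+0 (zExps (prodM (factor bs))) j ⟩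
    lookup (zExps (prodM (factor bs))) j           ≡⟨ lookup-prodM zExps (λ _ _ → refl) refl (factor bs) j ⟩
    sumFin (λ i → lookup (zExps (factor bs i)) j)  ≡⟨ sumFin-supported j _ (λ i → zExp-factor-offDiag bs) ⟩
    lookup (zExps (factor bs j)) j                 ≡⟨ zExp-factor-diag bs j ⟩
    (if lookup bs j then 1 else 0)                   ∎
    where open ≡-Reasoning

  xExp-subsetMono : ∀ bs j → lookup (xExps (subsetMono bs)) j ≡ subsetSum (lookup bs) (λ i → h i j) + c j
  xExp-subsetMono bs j = trans (VP.lookup-zipWith _+_ j (xExps (prodM (factor bs))) (tabulate c))
    (cong₂ _+_ (trans (lookup-prodM xExps (λ _ _ → refl) refl (factor bs) j)
                      (sumFin-cong (λ i → xExp-factor bs i j)))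
               (VP.lookup∘tabulate c j))

  subsetMono-injective : Injective _≡_ _≡_ subsetMono
  subsetMono-injective {bs} {bs′} eq = begin
    bs                     ≡⟨ sym (VP.tabulate∘lookup bs) ⟩
    tabulate (lookup bs)   ≡⟨ VP.tabulate-cong (λ j → bit-injective (zExps≡ j)) ⟩
    tabulate (lookup bs′)  ≡⟨ VP.tabulate∘lookup bs′ ⟩
    bs′                    ∎
    where
    open ≡-Reasoning
    zExps≡ : ∀ j → (if lookup bs j then 1 else 0) ≡ (if lookup bs′ j then 1 else 0)
    zExps≡ j =
      trans (sym (zExp-subsetMono bs j)) (trans (cong (λ m → lookup (zExps m) j) eq) (zExp-subsetMono bs′ j))
    bit-injective : ∀ {b b′} → (if b then 1 else 0) ≡ (if b′ then 1 else 0) → b ≡ b′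
    bit-injective {true}  {true}  _ = refl
    bit-injective {false} {false} _ = refl

  yExp+zExp≡1 : ∀ bs j → lookup (yExps (subsetMono bs)) j + lookup (zExps (subsetMono bs)) j ≡ 1
  yExp+zExp≡1 bs j = trans (cong₂ _+_ (yExp-subsetMono bs j) (zExp-subsetMono bs j)) (one-of (lookup bs j))
    where
    one-of : ∀ b → (if b then 0 else 1) + (if b then 1 else 0) ≡ 1
    one-of true  = refl
    one-of false = refl

  deg-subsetMono : ∀ bs → deg (subsetMono bs) ≡ n + sumFin (lookup (xExps (subsetMono bs)))
  deg-subsetMono bs =
    trans (deg≡sumFin (subsetMono bs)) (cong (_+ sumFin (lookup (xExps (subsetMono bs)))) yz-degree)
    where
    yz-degree : sumFin (lookup (yExps (subsetMono bs))) + sumFin (lookup (zExps (subsetMono bs))) ≡ n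
    yz-degree = begin
      sumFin (lookup (yExps (subsetMono bs))) + sumFin (lookup (zExps (subsetMono bs)))
        ≡⟨ sym (sumFin-distrib-+ (lookup (yExps (subsetMono bs))) _) ⟩
      sumFin (λ j → lookup (yExps (subsetMono bs)) j + lookup (zExps (subsetMono bs)) j)
        ≡⟨ sumFin-cong (yExp+zExp≡1 bs) ⟩
      sumFin {n} (λ _ → 1)
        ≡⟨ trans (sumFin-const n 1) (*-identityʳ n) ⟩
      n ∎
      where open ≡-Reasoning

  rMono-deg⇔ : ∀ {r} → 1 ≤ r → ∀ bs →
    (IsRMono r (subsetMono bs) × deg (subsetMono bs) ≡ t * r + n) ⇔
    (∀ j → lookup (xExps (subsetMono bs)) j ≡ r)
  rMono-deg⇔ {r} 1≤r bs = mk⇔ allExps≡r fromExps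
    where
    y z : Fin n → ℕ
    y = lookup (yExps (subsetMono bs))
    z = lookup (zExps (subsetMono bs))
    x : Fin t → ℕ
    x = lookup (xExps (subsetMono bs))
    allExps≡r : IsRMono r (subsetMono bs) × deg (subsetMono bs) ≡ t * r + n → ∀ j → x j ≡ r
    allExps≡r ((_ , _ , x≤r) , deg≡) = sumFin-≤-≡⇒≗ x≤r (+-cancelˡ-≡ n _ _ (begin
      n + sumFin x           ≡⟨ sym (deg-subsetMono bs) ⟩
      deg (subsetMono bs)    ≡⟨ trans deg≡ (+-comm (t * r) n) ⟩
      n + t * r              ≡⟨ cong (n +_) (sym (sumFin-const t r)) ⟩
      n + sumFin {t} (λ _ → r) ∎))
      where open ≡-Reasoning
    fromExps : (∀ j → x j ≡ r) → IsRMono r (subsetMono bs) × deg (subsetMono bs) ≡ t * r + n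
    fromExps x≡r = (y≤r , z≤r , ≤-reflexive ∘ x≡r) , (begin
      deg (subsetMono bs)    ≡⟨ deg-subsetMono bs ⟩
      n + sumFin x           ≡⟨ cong (n +_) (trans (sumFin-cong x≡r) (sumFin-const t r)) ⟩
      n + t * r              ≡⟨ +-comm n (t * r) ⟩
      t * r + n              ∎)
      where
      open ≡-Reasoning
      y≤r : ∀ j → y j ≤ r
      y≤r j = ≤-trans (subst (y j ≤_) (yExp+zExp≡1 bs j) (m≤m+n (y j) (z j))) 1≤r
      z≤r : ∀ j → z j ≤ r
      z≤r j = ≤-trans (subst (z j ≤_) (yExp+zExp≡1 bs j) (m≤n+m (z j) (y j))) 1≤r

  Contains-filter⇔ : ∀ {P : Mono n t → Set} (P? : Decidable P) m →
    Contains (filter P? (map subsetMono (allBits n))) m ⇔ (P m × ∃ λ bs → subsetMono bs ≡ m)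
  Contains-filter⇔ {P} P? m = mk⇔ fromContains toContains
    where
    X : Poly n t
    X = map subsetMono (allBits n)
    occ≢0 : ∀ {Y} → Contains Y m → occ _≟M_ m Y ≢ 0
    occ≢0 contains occ≡0 = 0≢1+n (trans (sym (cong (_% 2) occ≡0)) contains)
    fromContains : Contains (filter P? X) m → P m × ∃ λ bs → subsetMono bs ≡ m
    fromContains contains with P? m
    ... | no ¬pm = ⊥-elim (occ≢0 {filter P? X} contains (occ-filter-reject _≟M_ P? X ¬pm))
    ... | yes pm = pm , occ-map⇒preimage _≟B_ _≟M_ subsetMono m (allBits n)
                          (occ≢0 {filter P? X} contains ∘ trans (occ-filter-accept _≟M_ P? X pm))
    toContains : P m × (∃ λ bs → subsetMono bs ≡ m) → Contains (filter P? X) m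
    toContains (pm , bs , refl) = cong (_% 2) (begin
      occ _≟M_ (subsetMono bs) (filter P? X)  ≡⟨ occ-filter-accept _≟M_ P? X pm ⟩
      occ _≟M_ (subsetMono bs) X              ≡⟨ occ-map-injective _≟B_ _≟M_ subsetMono subsetMono-injective
                                                                   bs (allBits n) ⟩
      occ _≟B_ bs (allBits n)                 ≡⟨ occ-allBits bs ⟩
      1                                       ∎)
      where open ≡-Reasoning

m+[n∸o]≡n⇔m≡o : ∀ {m n o} → o ≤ n → m + (n ∸ o) ≡ n ⇔ m ≡ o
m+[n∸o]≡n⇔m≡o {m} {n} {o} o≤n =
  mk⇔ (λ eq → +-cancelʳ-≡ (n ∸ o) m o (trans eq (sym (m+[n∸m]≡n o≤n))))
      (λ { refl → m+[n∸m]≡n o≤n })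

block≤rPar : ∀ q j x → block q j x ≤ rPar q
block≤rPar q j x =
  subst (block q j x ≤_) (pred[m∸n]≡m∸[1+n] (10 ^ q) 0) (<⇒≤pred (m%n<n _ (10 ^ q) {{m^n≢0 10 q}}))

1≤rPar : ∀ {q} → 1 ≤ q → 1 ≤ rPar q
1≤rPar 1≤q = ≤-trans (s≤s z≤n) (∸-monoˡ-≤ 1 (^-monoʳ-≤ 10 1≤q))

1≤blockLength : ∀ {n t q} → 1 ≤ t → t ≤ n → t * q ≡ n → 1 ≤ q
1≤blockLength {t = t} {zero} 1≤t t≤n t*0≡n
  with ≤-trans 1≤t (subst (t ≤_) (trans (sym t*0≡n) (*-zeroʳ t)) t≤n)
... | ()
1≤blockLength {q = suc q} _ _ _ = s≤s z≤n

module Reduction {n t : ℕ} (q s : ℕ) (a : Fin n → ℕ) where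

  open SubsetMonomial {n} {t} (λ i j → block q (toℕ j) (a i)) (λ j → rPar q ∸ block q (toℕ j) s) public

  deg≟k : Decidable (λ (m : Mono n t) → deg m ≡ kPar n t q)
  deg≟k m = deg m ≟ kPar n t q

  pS≡filter : pS n t q s a ≡ filter deg≟k (map subsetMono (allBits n))
  pS≡filter = cong (filter deg≟k) expansion

  xExp≡r⇔blockSum : ∀ bs (j : Fin t) → lookup (xExps (subsetMono bs)) j ≡ rPar q ⇔
    subsetSum (lookup bs) (λ i → block q (toℕ j) (a i)) ≡ block q (toℕ j) s
  xExp≡r⇔blockSum bs j =
    subst (λ e → e ≡ rPar q ⇔ subsetSum (lookup bs) (λ i → block q (toℕ j) (a i)) ≡ block q (toℕ j) s)
      (sym (xExp-subsetMono bs j))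
      (m+[n∸o]≡n⇔m≡o (block≤rPar q (toℕ j) s))

  subsetSum⇔rMono-deg : IsCLSSInstance n s a → 1 ≤ t → t ≤ n → t * q ≡ n → ∀ bs →
    subsetSum (lookup bs) a ≡ s ⇔ (IsRMono (rPar q) (subsetMono bs) × deg (subsetMono bs) ≡ kPar n t q)
  subsetSum⇔rMono-deg inst 1≤t t≤n t*q≡n bs =
    ⇔.trans (subsetSum⇔blockSums t q s a inst t*q≡n (lookup bs))
    (⇔.trans (mk⇔ (λ blockSums j → from (xExp≡r⇔blockSum bs j) (blockSums j))
                  (λ xExps≡r j → to (xExp≡r⇔blockSum bs j) (xExps≡r j)))
             (⇔.sym (rMono-deg⇔ (1≤rPar (1≤blockLength 1≤t t≤n t*q≡n)) bs)))

proposition21 : (n t q s : ℕ) (a : Fin n → ℕ) →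
    IsCLSSInstance n s a → 1 ≤ t → t ≤ n → t * q ≡ n →
    (YesInstance n s a ⇔ ∃ λ (m : Mono n t) → IsRMono (rPar q) m × Contains (pS n t q s a) m)
proposition21 n t q s a inst 1≤t t≤n t*q≡n = mk⇔ yes⇒contains contains⇒yes
  where
  open Reduction {n} {t} q s a
  reduction : ∀ bs →
    subsetSum (lookup bs) a ≡ s ⇔ (IsRMono (rPar q) (subsetMono bs) × deg (subsetMono bs) ≡ kPar n t q)
  reduction = subsetSum⇔rMono-deg inst 1≤t t≤n t*q≡n
  yes⇒contains : YesInstance n s a → ∃ λ m → IsRMono (rPar q) m × Contains (pS n t q s a) m
  yes⇒contains (S , sum≡s) = subsetMono bs , proj₁ admissible ,
    subst (λ P → Contains P (subsetMono bs)) (sym pS≡filter)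
          (from (Contains-filter⇔ deg≟k (subsetMono bs)) (proj₂ admissible , bs , refl))
    where
    bs : Vec Bool n
    bs = tabulate S
    admissible : IsRMono (rPar q) (subsetMono bs) × deg (subsetMono bs) ≡ kPar n t q
    admissible = to (reduction bs)
      (trans (sumFin-cong (λ i → cong (if_then a i else 0) (VP.lookup∘tabulate S i))) sum≡s)
  contains⇒yes : (∃ λ m → IsRMono (rPar q) m × Contains (pS n t q s a) m) → YesInstance n s a
  contains⇒yes (m , rMono , contains)
    with to (Contains-filter⇔ deg≟k m) (subst (λ P → Contains P m) pS≡filter contains)
  ... | deg≡k , bs , refl = lookup bs , from (reduction bs) (rMono , deg≡k)
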